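{- For every integer $m\ge 1$ and every $n$, there is an injection from $Q_6(m,n)$ to $P_6(-m,n)$.
   Context: Partitions: $\ell(\mu)$ is the number of parts, $s(\mu)$ the smallest part ($s(\emptyset)=+\infty$), $\mu_i=0$ if $\mu$ has fewer than $i$ parts, rank of $\lambda$ is $\lambda_1-\ell(\lambda)$. The rank-set of $\lambda=(\lambda_1\ge\cdots\ge\lambda_\ell>0)$ is $[-\lambda_1,1-\lambda_2,\ldots,\ell-1-\lambda_\ell,\ell,\ell+1,\ldots]$. Fix $m\ge0$. The $m$-Durfee rectangle of $\lambda$ is the largest rectangle with $m+j$ rows and $j$ columns inside the Ferrers diagram (so $j$ is the largest integer with $j=0$ or $\lambda_{m+j}\ge j$). The $m$-Durfee rectangle symbol is $(\alpha,\beta)_{(m+j)\times j}$ with $\alpha_i=\lambda'_{j+i}$ (column lengths to the right of the rectangle, $\lambda'$ the conjugate) and $\beta=(\lambda_{m+j+1},\ldots)$ (rows below the rectangle). $Q(m,n)$ is the set of partitions of $n$ with $m$ in the rank-set; $P(-m,n)$ the set of partitions of $n$ with rank $\ge -m$. $Q_6(m,n)$ is the set of $\lambda\in Q(m,n)$ whose symbol satisfies $j\ge1$, $\ell(\beta)-\ell(\alpha)\ge1$, $\alpha_1=\alpha_2=\alpha_3=m+j$ and $s(\beta)\ge2$. $P_6(-m,n)$ is the set of $\mu\in P(-m,n)$ whose symbol $(\gamma,\delta)_{(m+j')\times j'}$ satisfies $j'\ge1$, $\ell(\gamma)=\ell(\delta)$, $\gamma_1=m+j'-2$ and $\delta_1=j'$.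 -}

module Defs where

open import Data.Nat using (ℕ; zero; suc; _+_; _∸_; _≤_; _≥_; _<_; _≤?_)
open import Data.Integer as ℤ using (ℤ; +_; -_)
open import Data.Nat.ListAction using (sum)
open import Data.List using (List; []; _∷_; length; map; filter; drop; upTo)
open import Data.List.Relation.Unary.All using (All)
open import Data.List.Relation.Unary.Linked using (Linked)
open import Data.Product using (Σ; ∃; _×_; _,_; proj₁)
open import Data.Sum using (_⊎_)
open import Relation.Binary.PropositionalEquality using (_≡_)

IsPartition : ℕ → List ℕ → Set
IsPartition n l = Linked _≥_ l × All (1 ≤_) l × sum l ≡ n

-- 1-indexed part μ_i, with μ_i = 0 if μ has fewer than i parts (and μ_0 := 0, unused).
part : List ℕ → ℕ → ℕ
part []       _             = 0
part (x ∷ xs) zero          = 0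
part (x ∷ xs) (suc zero)    = x
part (x ∷ xs) (suc (suc i)) = part xs (suc i)

conj : List ℕ → ℕ → ℕ
conj l k = length (filter (k ≤?_) l)

InRankSet : ℤ → List ℕ → Set
InRankSet r l =
  (∃ λ i → 1 ≤ i × i ≤ length l × r ≡ (+ (i ∸ 1)) ℤ.- (+ part l i))
  ⊎ (∃ λ k → length l ≤ k × r ≡ + k)

rank : List ℕ → ℤ
rank l = (+ part l 1) ℤ.- (+ length l)

IsDurfee : ℕ → List ℕ → ℕ → Set
IsDurfee m l j = (j ≡ 0 ⊎ part l (m + j) ≥ j)
               × (∀ k → part l (m + k) ≥ k → k ≤ j)

-- the two components of the m-Durfee rectangle symbol (α, β)_{(m+j)×j}
-- α_i = λ'_{j+i} for i = 1, …, λ₁ - j (the columns right of the rectangle)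
symα : List ℕ → ℕ → List ℕ
symα l j = map (λ i → conj l (j + suc i)) (upTo (part l 1 ∸ j))

symβ : ℕ → List ℕ → ℕ → List ℕ
symβ m l j = drop (m + j) l

Q : ℕ → ℕ → List ℕ → Set
Q m n l = IsPartition n l × InRankSet (+ m) l

P : ℕ → ℕ → List ℕ → Set
P m n l = IsPartition n l × (- (+ m)) ℤ.≤ rank l

-- Q₆(m,n) membership (s(β) ≥ 2 with s(∅)=+∞ is: every part of β is ≥ 2)
InQ6 : ℕ → ℕ → List ℕ → Set
InQ6 m n l = Q m n l × Σ ℕ λ j → IsDurfee m l j × 1 ≤ j
  × length (symα l j) < length (symβ m l j)
  × part (symα l j) 1 ≡ m + j × part (symα l j) 2 ≡ m + j × part (symα l j) 3 ≡ m + j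
  × All (2 ≤_) (symβ m l j)

InP6 : ℕ → ℕ → List ℕ → Set
InP6 m n l = P m n l × Σ ℕ λ j → IsDurfee m l j × 1 ≤ j
  × length (symα l j) ≡ length (symβ m l j)
  × part (symα l j) 1 ≡ m + j ∸ 2
  × part (symβ m l j) 1 ≡ j

Q6 : ℕ → ℕ → Set
Q6 m n = Σ (List ℕ) (InQ6 m n)

P6 : ℕ → ℕ → Set
P6 m n = Σ (List ℕ) (InP6 m n)

-- Write m = m′ + 1. For λ ∈ Q₆(m,n) with m-Durfee size j, the conditions α₁ = α₃ = m + j say
-- that the first m + j rows of λ are longer than j + 2 and all later rows are at most j; then
-- m ∈ rank-set forces λ_{m+j+1} = j, and ℓ(α) < ℓ(β) becomes λ₁ ≤ j + ℓ(β) − 1.  So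
-- λ = (λ₁, …, λ_{m+j}, j, β₂, β₃, …) with 2 ≤ βᵢ ≤ j, and j ≥ 2.  With w = λ_{j+1} and
-- z = w − j − 3 it is sent to
--     μ = (L, T, j+1, j+1, j+1, τ),
-- where σ = (λ₁ − w + m′ mod 2, λ₂ − w, …, λ_j − w), τ is one more than the conjugate of σ
-- read over N = ℓ(β) − 1 + z + ⌊m′/2⌋ columns, T = (w − 1 + β′₃, …, w − 1 + β′_j,
-- λ_{j+1} − 1, …, λ_{m+j} − 1) with β′ the conjugate of (β₂, β₃, …), and L = j + 2 + N.
-- The m-Durfee rectangle of μ is (m + j + 1) × (j + 1), which puts μ in P₆(−m,n); splitting m′
-- into its parity and twice its half makes the cell count of μ a polynomial identity.
-- The Durfee rectangle of μ gives back j, T gives back λ_{j+1}, …, λ_{m+j} and β′₃, …, β′_j,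
-- the length of τ gives back β′₁ = β′₂ = ℓ(β) − 1, and σ, hence λ₁, …, λ_j, is the conjugate of
-- τ − 1; so the map is injective.

module Submission where

open import Data.Nat as ℕ using (ℕ; zero; suc; _+_; _*_; _∸_; _≤_; _≥_; _<_; _≤?_; _<?_; z≤n; s≤s; s≤s⁻¹)
open import Data.Nat.Properties
open import Algebra.Properties.CommutativeSemigroup +-commutativeSemigroup using (interchange)
open import Data.Nat.DivMod using (_/_; _%_; m≡m%n+[m/n]*n; m%n<n)
open import Data.Nat.ListAction using (sum)
open import Data.Nat.ListAction.Properties using (sum-++)
open import Data.Nat.Tactic.RingSolver using (solve-∀)
open import Data.Integer as ℤ using (ℤ; _⊖_)
import Data.Integer.Properties as ℤ
import Data.Integer.Tactic.RingSolver as ℤ-Solver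
open import Data.List using (List; []; _∷_; _++_; length; map; filter; drop; upTo; applyUpTo)
open import Data.List.Properties
  using (filter-accept; filter-reject; filter-++; length-filter; length-++; length-map; length-applyUpTo; length-upTo;
         map-upTo; ∷-injective; ∷-injectiveˡ; ∷-injectiveʳ; drop-drop)
open import Data.List.Relation.Unary.All as All using (All; []; _∷_)
import Data.List.Relation.Unary.All.Properties as All
open import Data.List.Relation.Unary.AllPairs as AllPairs using (AllPairs; []; _∷_)
import Data.List.Relation.Unary.AllPairs.Properties as AllPairs
open import Data.List.Relation.Unary.Linked.Properties using (Linked⇒AllPairs; AllPairs⇒Linked)
open import Data.Product using (Σ; ∃; ∃₂; _×_; _,_; proj₁; proj₂)
open import Data.Sum using (_⊎_; inj₁; inj₂)
open import Data.Empty using (⊥-elim)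
open import Function using (_∘_)
open import Relation.Binary.PropositionalEquality hiding (J)
open import Relation.Nullary using (yes; no)

open import Defs

Sorted : List ℕ → Set
Sorted = AllPairs _≥_

sorted-++ : ∀ {c xs ys} → Sorted xs → Sorted ys → All (c ≤_) xs → All (_≤ c) ys → Sorted (xs ++ ys)
sorted-++ sxs sys xs≥c ys≤c =
  AllPairs.++⁺ sxs sys (All.map (λ c≤x → All.map (λ y≤c → ≤-trans y≤c c≤x) ys≤c) xs≥c)

sorted-++⁻ : ∀ xs {ys} → Sorted (xs ++ ys) → Sorted xs × Sorted ys × All (λ x → All (_≤ x) ys) xs
sorted-++⁻ []       s = [] , s , []
sorted-++⁻ (x ∷ xs) (x≥ ∷ s) with sorted-++⁻ xs s
... | sxs , sys , xs≥ys = All.++⁻ˡ xs x≥ ∷ sxs , sys , All.++⁻ʳ xs x≥ ∷ xs≥ys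

sorted-applyUpTo : ∀ {f : ℕ → ℕ} n → (∀ {i k} → i ≤ k → f k ≤ f i) → Sorted (applyUpTo f n)
sorted-applyUpTo zero    _    = []
sorted-applyUpTo (suc n) anti = All.applyUpTo⁺₂ _ n (λ _ → anti z≤n) ∷ sorted-applyUpTo n (anti ∘ s≤s)

applyUpTo-cong : ∀ {f g : ℕ → ℕ} n → (∀ i → f i ≡ g i) → applyUpTo f n ≡ applyUpTo g n
applyUpTo-cong zero    _   = refl
applyUpTo-cong (suc n) f≗g = cong₂ _∷_ (f≗g 0) (applyUpTo-cong n (f≗g ∘ suc))

applyUpTo-injective : ∀ {f g : ℕ → ℕ} n → applyUpTo f n ≡ applyUpTo g n → ∀ {i} → i < n → f i ≡ g i
applyUpTo-injective (suc n) eq {zero}  _         = ∷-injectiveˡ eq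
applyUpTo-injective (suc n) eq {suc i} (s≤s i<n) = applyUpTo-injective n (∷-injectiveʳ eq) i<n

sum-applyUpTo-+ : ∀ (f g : ℕ → ℕ) n →
  sum (applyUpTo (λ i → f i + g i) n) ≡ sum (applyUpTo f n) + sum (applyUpTo g n)
sum-applyUpTo-+ f g zero    = refl
sum-applyUpTo-+ f g (suc n) = begin
  f 0 + g 0 + sum (applyUpTo (λ i → f (suc i) + g (suc i)) n) ≡⟨ cong (f 0 + g 0 +_) (sum-applyUpTo-+ (f ∘ suc) (g ∘ suc) n) ⟩
  f 0 + g 0 + (F + G)                                        ≡⟨ interchange (f 0) (g 0) F G ⟩
  f 0 + F + (g 0 + G)                                        ∎
  where
  open ≡-Reasoning
  F = sum (applyUpTo (f ∘ suc) n)
  G = sum (applyUpTo (g ∘ suc) n)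

sum-applyUpTo-const : ∀ c n → sum (applyUpTo (λ _ → c) n) ≡ n * c
sum-applyUpTo-const c zero    = refl
sum-applyUpTo-const c (suc n) = cong (c +_) (sum-applyUpTo-const c n)

drop-length-++ : ∀ {A : Set} (xs : List A) {ys} → drop (length xs) (xs ++ ys) ≡ ys
drop-length-++ []       = refl
drop-length-++ (x ∷ xs) = drop-length-++ xs

++-injective : ∀ {A : Set} (xs xs′ : List A) {ys ys′} → length xs ≡ length xs′ →
  xs ++ ys ≡ xs′ ++ ys′ → xs ≡ xs′ × ys ≡ ys′
++-injective []       []         _   eq = refl , eq
++-injective (x ∷ xs) (x′ ∷ xs′) len eq with ∷-injective eq
... | refl , eq′ with ++-injective xs xs′ (suc-injective len) eq′
...   | refl , refl = refl , refl

split-around : ∀ {A : Set} a (xs : List A) → a < length xs →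
  ∃₂ λ ys zs → ∃ λ y → xs ≡ ys ++ y ∷ zs × length ys ≡ a
split-around zero    (x ∷ xs) _         = [] , xs , x , refl , refl
split-around (suc a) (x ∷ xs) (s≤s a<n) with split-around a xs a<n
... | ys , zs , y , eq , len = x ∷ ys , zs , y , cong (x ∷_) eq , cong suc len

map-∸-cancel : ∀ {w} xs → All (w ≤_) xs → map (_+ w) (map (_∸ w) xs) ≡ xs
map-∸-cancel []       []           = refl
map-∸-cancel (x ∷ xs) (w≤x ∷ w≤xs) = cong₂ _∷_ (m∸n+n≡m w≤x) (map-∸-cancel xs w≤xs)

map-∸-injective : ∀ {w} xs ys → All (w ≤_) xs → All (w ≤_) ys → map (_∸ w) xs ≡ map (_∸ w) ys → xs ≡ ys
map-∸-injective {w} xs ys w≤xs w≤ys eq = begin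
  xs                         ≡⟨ map-∸-cancel xs w≤xs ⟨
  map (_+ w) (map (_∸ w) xs) ≡⟨ cong (map (_+ w)) eq ⟩
  map (_+ w) (map (_∸ w) ys) ≡⟨ map-∸-cancel ys w≤ys ⟩
  ys                         ∎
  where open ≡-Reasoning

sum-map-∸ : ∀ {w} xs → All (w ≤_) xs → sum (map (_∸ w) xs) + length xs * w ≡ sum xs
sum-map-∸         []       []           = refl
sum-map-∸ {w} (x ∷ xs) (w≤x ∷ w≤xs) = begin
  x ∸ w + S + (w + length xs * w)   ≡⟨ interchange (x ∸ w) S w (length xs * w) ⟩
  (x ∸ w + w) + (S + length xs * w) ≡⟨ cong₂ _+_ (m∸n+n≡m w≤x) (sum-map-∸ xs w≤xs) ⟩
  x + sum xs                        ∎
  where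
  open ≡-Reasoning
  S = sum (map (_∸ w) xs)

-- Parts and conjugates

part-All : ∀ {P : ℕ → Set} xs i → All P xs → P 0 → P (part xs i)
part-All []       _             _        P0 = P0
part-All (x ∷ xs) zero          _        P0 = P0
part-All (x ∷ xs) (suc zero)    (Px ∷ _) _  = Px
part-All (x ∷ xs) (suc (suc i)) (_ ∷ Ps) P0 = part-All xs (suc i) Ps P0

All-part : ∀ {P : ℕ → Set} xs {i} → All P xs → i < length xs → P (part xs (suc i))
All-part (x ∷ xs) {zero}  (Px ∷ _) _         = Px
All-part (x ∷ xs) {suc i} (_ ∷ Ps) (s≤s i<n) = All-part xs Ps i<n

part-++ˡ : ∀ xs ys {i} → i < length xs → part (xs ++ ys) (suc i) ≡ part xs (suc i)
part-++ˡ (x ∷ xs) ys {zero}  _         = refl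
part-++ˡ (x ∷ xs) ys {suc i} (s≤s i<n) = part-++ˡ xs ys i<n

part-++ʳ : ∀ xs ys i → part (xs ++ ys) (suc (length xs + i)) ≡ part ys (suc i)
part-++ʳ []       ys i = refl
part-++ʳ (x ∷ xs) ys i = part-++ʳ xs ys i

part-applyUpTo : ∀ (f : ℕ → ℕ) n {i} → i < n → part (applyUpTo f n) (suc i) ≡ f i
part-applyUpTo f (suc n) {zero}  _         = refl
part-applyUpTo f (suc n) {suc i} (s≤s i<n) = part-applyUpTo (f ∘ suc) n i<n

part-applyUpTo-≥ : ∀ (f : ℕ → ℕ) n {i} → n ≤ i → part (applyUpTo f n) (suc i) ≡ 0
part-applyUpTo-≥ f zero    _         = refl
part-applyUpTo-≥ f (suc n) (s≤s n≤i) = part-applyUpTo-≥ (f ∘ suc) n n≤i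

conj-∷-≥ : ∀ {k x} xs → k ≤ x → conj (x ∷ xs) k ≡ suc (conj xs k)
conj-∷-≥ {k} xs k≤x = cong length (filter-accept (k ≤?_) k≤x)

conj-∷-< : ∀ {k x} xs → x < k → conj (x ∷ xs) k ≡ conj xs k
conj-∷-< {k} xs x<k = cong length (filter-reject (k ≤?_) (<⇒≱ x<k))

conj-++ : ∀ xs ys k → conj (xs ++ ys) k ≡ conj xs k + conj ys k
conj-++ xs ys k = trans (cong length (filter-++ (k ≤?_) xs ys)) (length-++ (filter (k ≤?_) xs))

conj-≡length : ∀ {k} xs → All (k ≤_) xs → conj xs k ≡ length xs
conj-≡length []       []          = refl
conj-≡length (x ∷ xs) (k≤x ∷ k≤xs) = trans (conj-∷-≥ xs k≤x) (cong suc (conj-≡length xs k≤xs))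

conj-≡0 : ∀ {k} xs → All (_< k) xs → conj xs k ≡ 0
conj-≡0 []       []          = refl
conj-≡0 (x ∷ xs) (x<k ∷ xs<k) = trans (conj-∷-< xs x<k) (conj-≡0 xs xs<k)

conj-≡0⁻ : ∀ {k} xs → conj xs k ≡ 0 → All (_< k) xs
conj-≡0⁻ []           _  = []
conj-≡0⁻ {k} (x ∷ xs) eq with k ≤? x
... | yes k≤x = ⊥-elim (1+n≢0 (trans (sym (conj-∷-≥ xs k≤x)) eq))
... | no  k≰x = ≰⇒> k≰x ∷ conj-≡0⁻ xs (trans (sym (conj-∷-< xs (≰⇒> k≰x))) eq)

conj-≤length : ∀ xs k → conj xs k ≤ length xs
conj-≤length xs k = length-filter (k ≤?_) xs

conj-antitone : ∀ xs {k k′} → k ≤ k′ → conj xs k′ ≤ conj xs k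
conj-antitone []       _ = z≤n
conj-antitone (x ∷ xs) {k} {k′} k≤k′ with k′ ≤? x | k ≤? x
... | yes k′≤x | _       = subst₂ _≤_ (sym (conj-∷-≥ xs k′≤x)) (sym (conj-∷-≥ xs (≤-trans k≤k′ k′≤x)))
                                 (s≤s (conj-antitone xs k≤k′))
... | no  k′≰x | yes k≤x = subst₂ _≤_ (sym (conj-∷-< xs (≰⇒> k′≰x))) (sym (conj-∷-≥ xs k≤x))
                                 (m≤n⇒m≤1+n (conj-antitone xs k≤k′))
... | no  k′≰x | no  k≰x = subst₂ _≤_ (sym (conj-∷-< xs (≰⇒> k′≰x))) (sym (conj-∷-< xs (≰⇒> k≰x)))
                                 (conj-antitone xs k≤k′)

conj-∷-cancel : ∀ x xs ys k → conj (x ∷ xs) k ≡ conj (x ∷ ys) k → conj xs k ≡ conj ys k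
conj-∷-cancel x xs ys k eq =
  +-cancelˡ-≡ (conj (x ∷ []) k) _ _ (trans (sym (conj-++ (x ∷ []) xs k)) (trans eq (conj-++ (x ∷ []) ys k)))

sum-conj-singleton : ∀ x n → x ≤ n → sum (applyUpTo (λ i → conj (x ∷ []) (suc i)) n) ≡ x
sum-conj-singleton zero    zero    _       = refl
sum-conj-singleton zero    (suc n) _       = sum-conj-singleton zero n z≤n
sum-conj-singleton (suc x) (suc n) (s≤s x≤n) =
  cong suc (trans (cong sum (applyUpTo-cong n shift)) (sum-conj-singleton x n x≤n))
  where
  shift : ∀ i → conj (suc x ∷ []) (suc (suc i)) ≡ conj (x ∷ []) (suc i)
  shift i with suc i ≤? x
  ... | yes i<x = trans (conj-∷-≥ [] (s≤s i<x)) (sym (conj-∷-≥ [] i<x))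
  ... | no  i≮x = trans (conj-∷-< [] (s≤s (≰⇒> i≮x))) (sym (conj-∷-< [] (≰⇒> i≮x)))

sum-conj : ∀ {n} xs → All (_≤ n) xs → sum (applyUpTo (λ i → conj xs (suc i)) n) ≡ sum xs
sum-conj {n} []       []          = trans (sum-applyUpTo-const 0 n) (*-zeroʳ n)
sum-conj {n} (x ∷ xs) (x≤n ∷ xs≤n) = begin
  sum (applyUpTo (λ i → conj (x ∷ xs) (suc i)) n)
    ≡⟨ cong sum (applyUpTo-cong n (λ i → conj-++ (x ∷ []) xs (suc i))) ⟩
  sum (applyUpTo (λ i → conj (x ∷ []) (suc i) + conj xs (suc i)) n)
    ≡⟨ sum-applyUpTo-+ (λ i → conj (x ∷ []) (suc i)) (λ i → conj xs (suc i)) n ⟩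
  sum (applyUpTo (λ i → conj (x ∷ []) (suc i)) n) + sum (applyUpTo (λ i → conj xs (suc i)) n)
    ≡⟨ cong₂ _+_ (sum-conj-singleton x n x≤n) (sum-conj xs xs≤n) ⟩
  x + sum xs ∎
  where open ≡-Reasoning

conj-agree⇒≤-head : ∀ {n x y} xs ys → Sorted (x ∷ xs) → y ≤ n →
  (∀ {i} → i < n → conj (x ∷ xs) (suc i) ≡ conj (y ∷ ys) (suc i)) → y ≤ x
conj-agree⇒≤-head {n} {x} {y} xs ys (x≥xs ∷ _) y≤n same with y ≤? x
... | yes y≤x = y≤x
... | no  y≰x with ≰⇒> y≰x
...   | x<y@(s≤s _) = ⊥-elim (0≢1+n (begin
  0               ≡⟨ conj-≡0 (x ∷ xs) (x<y ∷ All.map (λ z≤x → ≤-<-trans z≤x x<y) x≥xs) ⟨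
  conj (x ∷ xs) y ≡⟨ same y≤n ⟩
  conj (y ∷ ys) y ≡⟨ conj-∷-≥ ys ≤-refl ⟩
  suc (conj ys y) ∎))
  where open ≡-Reasoning

conj-injective : ∀ {n} xs ys → Sorted xs → Sorted ys → length xs ≡ length ys →
  All (_≤ n) xs → All (_≤ n) ys → (∀ {i} → i < n → conj xs (suc i) ≡ conj ys (suc i)) → xs ≡ ys
conj-injective []       []       _              _              _   _            _            _    = refl
conj-injective (x ∷ xs) (y ∷ ys) sx@(_ ∷ sxs) sy@(_ ∷ sys) len (x≤n ∷ xs≤n) (y≤n ∷ ys≤n) same
  with ≤-antisym (conj-agree⇒≤-head ys xs sy x≤n (sym ∘ same)) (conj-agree⇒≤-head xs ys sx y≤n same)
... | refl = cong (x ∷_) (conj-injective xs ys sxs sys (suc-injective len) xs≤n ys≤n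
                            (λ i<n → conj-∷-cancel x xs ys _ (same i<n)))

sorted-split-conj : ∀ k {l} → Sorted l →
  ∃₂ λ xs ys → l ≡ xs ++ ys × length xs ≡ conj l k × All (k ≤_) xs × All (_< k) ys
sorted-split-conj k {[]}    []         = [] , [] , refl , refl , [] , []
sorted-split-conj k {x ∷ l} (x≥l ∷ sl) with k ≤? x
... | yes k≤x =
  let xs , ys , eq , len , xs≥k , ys<k = sorted-split-conj k sl
  in  x ∷ xs , ys , cong (x ∷_) eq , trans (cong suc len) (sym (conj-∷-≥ l k≤x)) , k≤x ∷ xs≥k , ys<k
... | no  k≰x = [] , x ∷ l , refl , sym (conj-≡0 (x ∷ l) x∷l<k) , [] , x∷l<k
  where
  x∷l<k : All (_< k) (x ∷ l)
  x∷l<k = ≰⇒> k≰x ∷ All.map (λ y≤x → ≤-<-trans y≤x (≰⇒> k≰x)) x≥l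

-- Rank sets and m-Durfee symbols

IsDurfee-unique : ∀ {m l a b} → IsDurfee m l a → IsDurfee m l b → a ≡ b
IsDurfee-unique {m} {l} da db = ≤-antisym (below da db) (below db da)
  where
  below : ∀ {a b} → IsDurfee m l a → IsDurfee m l b → a ≤ b
  below (inj₁ refl , _) _             = z≤n
  below (inj₂ fits , _) (_ , maximal) = maximal _ fits

InRankSet-≥0 : ∀ {m l} → InRankSet (ℤ.+ m) l →
  (∃ λ i → i < length l × i ≡ m + part l (suc i)) ⊎ length l ≤ m
InRankSet-≥0 {m} {l} (inj₁ (suc i , _ , i<ℓ , eq)) = inj₁ (i , i<ℓ , ℤ.+-injective (begin
  ℤ.+ i                     ≡⟨ minus-plus (ℤ.+ i) (ℤ.+ p) ⟨
  ℤ.+ i ℤ.- ℤ.+ p ℤ.+ ℤ.+ p ≡⟨ cong (ℤ._+ ℤ.+ p) eq ⟨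
  ℤ.+ m ℤ.+ ℤ.+ p           ≡⟨ ℤ.pos-+ m p ⟨
  ℤ.+ (m + p)               ∎))
  where
  open ≡-Reasoning
  p = part l (suc i)
  minus-plus : ∀ (a b : ℤ) → a ℤ.- b ℤ.+ b ≡ a
  minus-plus = ℤ-Solver.solve-∀
InRankSet-≥0 (inj₂ (k , ℓ≤k , eq)) = inj₂ (subst (_ ≤_) (sym (ℤ.+-injective eq)) ℓ≤k)

[+m]-[+[m+n]]≡-[+n] : ∀ m n → ℤ.+ m ℤ.- ℤ.+ (m + n) ≡ ℤ.- ℤ.+ n
[+m]-[+[m+n]]≡-[+n] m n = begin
  ℤ.+ m ℤ.- ℤ.+ (m + n)  ≡⟨ ℤ.[+m]-[+n]≡m⊖n m (m + n) ⟩
  m ⊖ (m + n)            ≡⟨ cong (_⊖ (m + n)) (+-identityʳ m) ⟨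
  (m + 0) ⊖ (m + n)      ≡⟨ ℤ.+-cancelˡ-⊖ m 0 n ⟩
  0 ⊖ n                  ≡⟨ ℤ.⊖-≤ z≤n ⟩
  ℤ.- ℤ.+ n              ∎
  where open ≡-Reasoning

symα-part : ∀ l j {i} → i < part l 1 ∸ j → part (symα l j) (suc i) ≡ conj l (j + suc i)
symα-part l j i<A = trans (cong (λ xs → part xs _) (map-upTo _ (part l 1 ∸ j))) (part-applyUpTo _ _ i<A)

symα-part-≥ : ∀ l j {i} → part l 1 ∸ j ≤ i → part (symα l j) (suc i) ≡ 0
symα-part-≥ l j A≤i = trans (cong (λ xs → part xs _) (map-upTo _ (part l 1 ∸ j))) (part-applyUpTo-≥ _ _ A≤i)

length-symα : ∀ l j → length (symα l j) ≡ part l 1 ∸ j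
length-symα l j = trans (length-map _ (upTo (part l 1 ∸ j))) (length-upTo (part l 1 ∸ j))

-- Partitions (L, T, j+1, j+1, j+1, τ) in P₆

framed : ℕ → ℕ → List ℕ → List ℕ → List ℕ
framed J L T τ = L ∷ T ++ J ∷ J ∷ J ∷ τ

framed-IsDurfee : ∀ m j L T τ → All (_≤ suc j) τ → m + suc j ≡ 3 + length T →
  IsDurfee m (framed (suc j) L T τ) (suc j)
framed-IsDurfee m j L T τ τ≤J m+J≡ = inj₂ (≤-reflexive (sym at-corner)) , maximal
  where
  open ≡-Reasoning
  J = suc j
  Jτ = J ∷ J ∷ J ∷ τ
  μ = framed J L T τ
  t = length T
  Jτ≤J : All (_≤ J) Jτ
  Jτ≤J = ≤-refl ∷ ≤-refl ∷ ≤-refl ∷ τ≤J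
  at-corner : part μ (m + J) ≡ J
  at-corner = begin
    part μ (m + J)                ≡⟨ cong (part μ) (trans m+J≡ (cong (suc ∘ suc) (+-comm 1 t))) ⟩
    part (T ++ Jτ) (suc (t + 1))  ≡⟨ part-++ʳ T Jτ 1 ⟩
    J                             ∎
  below-corner : ∀ k → j ≤ k → part μ (m + suc k) ≡ part Jτ (suc (suc (k ∸ j)))
  below-corner k j≤k = begin
    part μ (m + suc k)                     ≡⟨ cong (part μ) index ⟩
    part (T ++ Jτ) (suc (t + suc (k ∸ j))) ≡⟨ part-++ʳ T Jτ (suc (k ∸ j)) ⟩
    part Jτ (suc (suc (k ∸ j)))            ∎
    where
    index : m + suc k ≡ suc (suc (t + suc (k ∸ j)))
    index = begin
      m + suc k                    ≡⟨ cong (λ x → m + suc x) (m+[n∸m]≡n j≤k) ⟨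
      m + suc (j + (k ∸ j))        ≡⟨ +-assoc m J (k ∸ j) ⟨
      m + J + (k ∸ j)              ≡⟨ cong (_+ (k ∸ j)) m+J≡ ⟩
      3 + t + (k ∸ j)              ≡⟨ cong (suc ∘ suc) (+-suc t (k ∸ j)) ⟨
      suc (suc (t + suc (k ∸ j)))  ∎
  maximal : ∀ k → part μ (m + k) ≥ k → k ≤ J
  maximal k k≤part with k ≤? J
  ... | yes k≤J = k≤J
  ... | no  k≰J with ≰⇒> k≰J
  ...   | s≤s {n = k′} J≤k′ = ⊥-elim (<⇒≱ (≰⇒> k≰J) (≤-trans k≤part
          (subst (_≤ J) (sym (below-corner k′ (≤-trans (n≤1+n j) J≤k′)))
                 (part-All Jτ (suc (suc (k′ ∸ j))) Jτ≤J z≤n))))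

symβ-framed : ∀ m j L T τ → m + suc j ≡ 3 + length T → symβ m (framed (suc j) L T τ) (suc j) ≡ suc j ∷ τ
symβ-framed m j L T τ m+J≡ = begin
  drop (m + suc j) (framed (suc j) L T τ) ≡⟨ cong (λ n → drop n (L ∷ T ++ Jτ)) (trans m+J≡ (cong suc (+-comm 2 t))) ⟩
  drop (t + 2) (T ++ Jτ)                   ≡⟨ drop-drop t 2 (T ++ Jτ) ⟨
  drop 2 (drop t (T ++ Jτ))                ≡⟨ cong (drop 2) (drop-length-++ T) ⟩
  suc j ∷ τ                                ∎
  where
  open ≡-Reasoning
  t = length T
  Jτ = suc j ∷ suc j ∷ suc j ∷ τ

framed-InP6 : ∀ m j L T τ → Sorted (L ∷ T) → All (suc (suc j) ≤_) T →
  Sorted τ → All (1 ≤_) τ → All (_≤ suc j) τ →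
  m + suc j ≡ 3 + length T → L ≡ suc j + suc (length τ) →
  InP6 m (sum (framed (suc j) L T τ)) (framed (suc j) L T τ)
framed-InP6 m j L T τ (L≥T ∷ sorted-T) T-large sorted-τ τ-pos τ≤J m+J≡ L≡ =
  ((AllPairs⇒Linked sorted-μ , positive , refl) , rank-bound) ,
  J , framed-IsDurfee m j L T τ τ≤J m+J≡ , s≤s z≤n ,
  length-αβ , α₁ , cong (λ l → part l 1) (symβ-framed m j L T τ m+J≡)
  where
  open ≡-Reasoning
  J = suc j
  Jτ = J ∷ J ∷ J ∷ τ
  μ = framed J L T τ
  t = length T
  Jτ≤J : All (_≤ J) Jτ
  Jτ≤J = ≤-refl ∷ ≤-refl ∷ ≤-refl ∷ τ≤J
  J<L : J < L
  J<L = subst (J <_) (sym L≡) (m<m+n J (s≤s z≤n))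
  sorted-μ : Sorted μ
  sorted-μ = All.++⁺ L≥T (All.map (λ x≤J → ≤-trans x≤J (<⇒≤ J<L)) Jτ≤J)
           ∷ sorted-++ sorted-T ((≤-refl ∷ ≤-refl ∷ τ≤J) ∷ (≤-refl ∷ τ≤J) ∷ τ≤J ∷ sorted-τ)
                       (All.map (≤-trans (n≤1+n J)) T-large) Jτ≤J
  positive : All (1 ≤_) μ
  positive = ≤-trans (s≤s z≤n) J<L
           ∷ All.++⁺ (All.map (≤-trans (s≤s z≤n)) T-large) (s≤s z≤n ∷ s≤s z≤n ∷ s≤s z≤n ∷ τ-pos)
  length-μ : length μ ≡ L + m
  length-μ = begin
    suc (length (T ++ Jτ))        ≡⟨ cong suc (length-++ T) ⟩
    suc (t + (3 + s))             ≡⟨ shuffle t s ⟩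
    3 + t + suc s                 ≡⟨ cong (_+ suc s) m+J≡ ⟨
    m + J + suc s                 ≡⟨ reorder m J (suc s) ⟩
    J + suc s + m                 ≡⟨ cong (_+ m) L≡ ⟨
    L + m                         ∎
    where
    s = length τ
    shuffle : ∀ t s → suc (t + (3 + s)) ≡ 3 + t + suc s
    shuffle = solve-∀
    reorder : ∀ m J s → m + J + s ≡ J + s + m
    reorder = solve-∀
  rank-bound : ℤ.- ℤ.+ m ℤ.≤ rank μ
  rank-bound = ℤ.≤-reflexive (sym (trans (cong (λ n → ℤ.+ L ℤ.- ℤ.+ n) length-μ) ([+m]-[+[m+n]]≡-[+n] L m)))
  L∸J : L ∸ J ≡ suc (length τ)
  L∸J = trans (cong (_∸ J) L≡) (m+n∸m≡n J (suc (length τ)))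
  length-αβ : length (symα μ J) ≡ length (symβ m μ J)
  length-αβ = begin
    length (symα μ J)          ≡⟨ length-symα μ J ⟩
    L ∸ J                      ≡⟨ L∸J ⟩
    length (J ∷ τ)             ≡⟨ cong length (symβ-framed m j L T τ m+J≡) ⟨
    length (symβ m μ J)        ∎
  α₁ : part (symα μ J) 1 ≡ m + J ∸ 2
  α₁ = begin
    part (symα μ J) 1                          ≡⟨ symα-part μ J (subst (0 <_) (sym L∸J) (s≤s z≤n)) ⟩
    conj μ (J + 1)                             ≡⟨ cong (conj μ) (+-comm J 1) ⟩
    conj (L ∷ T ++ Jτ) (suc J)                 ≡⟨ conj-∷-≥ (T ++ Jτ) J<L ⟩
    suc (conj (T ++ Jτ) (suc J))               ≡⟨ cong suc (conj-++ T Jτ (suc J)) ⟩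
    suc (conj T (suc J) + conj Jτ (suc J))     ≡⟨ cong₂ (λ a b → suc (a + b)) (conj-≡length T T-large)
                                                    (conj-≡0 Jτ (All.map s≤s Jτ≤J)) ⟩
    suc (t + 0)                                ≡⟨ cong suc (+-identityʳ t) ⟩
    suc t                                      ≡⟨ cong (_∸ 2) m+J≡ ⟨
    m + J ∸ 2                                  ∎

framed-injective : ∀ {J J′ L L′} T T′ {τ τ′} → length T ≡ length T′ →
  framed J L T τ ≡ framed J′ L′ T′ τ′ → T ≡ T′ × τ ≡ τ′
framed-injective T T′ |T| eq with ++-injective T T′ |T| (∷-injectiveʳ eq)
... | T≡ , Jτ≡ = T≡ , ∷-injectiveʳ (∷-injectiveʳ (∷-injectiveʳ Jτ≡))

-- The shape of a partition in Q₆

rank-set⇒≤-head : ∀ {m j b} R β → length R ≡ m + j → All (j + 3 ≤_) R → Sorted (b ∷ β) →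
  InRankSet (ℤ.+ m) (R ++ b ∷ β) → j ≤ b
rank-set⇒≤-head {m} {j} {b} R β |R| R-large (b≥β ∷ _) in-rank with InRankSet-≥0 {l = R ++ b ∷ β} in-rank
... | inj₂ ℓ≤m = ⊥-elim (<⇒≱ m<ℓ ℓ≤m)
  where
  m<ℓ : m < length (R ++ b ∷ β)
  m<ℓ = subst (m <_) (sym (trans (length-++ R) (cong (_+ _) |R|)))
              (≤-<-trans (m≤m+n m j) (m<m+n (m + j) (s≤s z≤n)))
... | inj₁ (i , _ , i≡) with i <? length R
...   | yes i<|R| = ⊥-elim (<⇒≱ (subst (i <_) |R| i<|R|)
                      (≤-trans (+-monoʳ-≤ m (≤-trans (m≤m+n j 3) (All-part R R-large i<|R|)))
                               (≤-reflexive (trans (cong (m +_) (sym (part-++ˡ R (b ∷ β) i<|R|))) (sym i≡)))))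
...   | no  i≮|R| = ≤-trans j≤p p≤b
  where
  p = part (R ++ b ∷ β) (suc i)
  |R|≤i : length R ≤ i
  |R|≤i = ≮⇒≥ i≮|R|
  j≤p : j ≤ p
  j≤p = +-cancelˡ-≤ m j p (subst₂ _≤_ |R| i≡ |R|≤i)
  p≤b : p ≤ b
  p≤b = subst (_≤ b) (sym (trans (cong (λ k → part (R ++ b ∷ β) (suc k)) (sym (m+[n∸m]≡n |R|≤i)))
                                 (part-++ʳ R (b ∷ β) (i ∸ length R))))
              (part-All (b ∷ β) (suc (i ∸ length R)) (≤-refl ∷ b≥β) z≤n)

Q6Rows : ℕ → List ℕ → Set
Q6Rows m l = ∃ λ j → ∃₂ λ R β → l ≡ R ++ j ∷ β × length R ≡ m + j × All (j + 3 ≤_) R × Sorted R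
                             × Sorted β × All (2 ≤_) β × All (_≤ j) β × part l 1 ≤ j + length β

Q6-rows : ∀ {m n l} → 1 ≤ m → InQ6 m n l → Q6Rows m l
Q6-rows {m} {n} {l} 1≤m (((linked , _ , _) , in-rank) , j , _ , _ , ℓα<ℓβ , α₁ , _ , α₃ , β-large) =
  rows (sorted-split-conj (j + 3) sorted)
  where
  sorted : Sorted l
  sorted = Linked⇒AllPairs (λ y≤x z≤y → ≤-trans z≤y y≤x) linked
  A = part l 1 ∸ j
  2<A : 2 < A
  2<A with 2 <? A
  ... | yes 2<A = 2<A
  ... | no  2≮A = ⊥-elim (<⇒≱ (≤-trans 1≤m (m≤m+n m j))
                                (≤-reflexive (trans (sym α₃) (symα-part-≥ l j (≮⇒≥ 2≮A)))))
  conj₁ : conj l (suc j) ≡ m + j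
  conj₁ = trans (cong (conj l) (+-comm 1 j)) (trans (sym (symα-part l j (≤-trans (s≤s z≤n) 2<A))) α₁)
  conj₃ : conj l (j + 3) ≡ m + j
  conj₃ = trans (sym (symα-part l j 2<A)) α₃
  symβ≡ : ∀ {R B} → l ≡ R ++ B → length R ≡ m + j → symβ m l j ≡ B
  symβ≡ {R} l≡ |R| = trans (cong₂ drop (sym |R|) l≡) (drop-length-++ R)
  rows : (∃₂ λ R B → l ≡ R ++ B × length R ≡ conj l (j + 3) × All (j + 3 ≤_) R × All (_< j + 3) B) → Q6Rows m l
  rows (R , [] , l≡ , |R| , _ , _) =
    ⊥-elim (n≮0 (subst (_ <_) (cong length (symβ≡ {R} l≡ (trans |R| conj₃))) ℓα<ℓβ))
  rows (R , b ∷ β , l≡ , |R|≡ , R-large , _) =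
    j , R , β , trans l≡ (cong (λ x → R ++ x ∷ β) (sym j≡b)) , |R| , R-large , sorted-R ,
    AllPairs.drop⁺ 1 sorted-B , All.tail (subst (All (2 ≤_)) (symβ≡ l≡ |R|) β-large) ,
    All.map s≤s⁻¹ (All.tail B<j+1) , ≤-trans (m≤n+m∸n (part l 1) j) (+-monoʳ-≤ j A≤|β|)
    where
    open ≡-Reasoning
    |R| : length R ≡ m + j
    |R| = trans |R|≡ conj₃
    sorted-R = proj₁ (sorted-++⁻ R (subst Sorted l≡ sorted))
    sorted-B = proj₁ (proj₂ (sorted-++⁻ R (subst Sorted l≡ sorted)))
    B<j+1 : All (_< suc j) (b ∷ β)
    B<j+1 = conj-≡0⁻ (b ∷ β) (+-cancelˡ-≡ (m + j) _ 0 (trans no-more (sym (+-identityʳ (m + j)))))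
      where
      no-more : m + j + conj (b ∷ β) (suc j) ≡ m + j
      no-more = begin
        m + j + conj (b ∷ β) (suc j)           ≡⟨ cong (_+ _) (trans (sym |R|) (sym (conj-≡length R
                                                    (All.map (≤-trans (m<m+n j (s≤s z≤n))) R-large)))) ⟩
        conj R (suc j) + conj (b ∷ β) (suc j)  ≡⟨ conj-++ R (b ∷ β) (suc j) ⟨
        conj (R ++ b ∷ β) (suc j)              ≡⟨ cong (λ l → conj l (suc j)) l≡ ⟨
        conj l (suc j)                         ≡⟨ conj₁ ⟩
        m + j                                  ∎
    j≡b : j ≡ b
    j≡b = ≤-antisym (rank-set⇒≤-head R β |R| R-large sorted-B (subst (InRankSet (ℤ.+ m)) l≡ in-rank))
                    (s≤s⁻¹ (All.head B<j+1))
    A≤|β| : A ≤ length β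
    A≤|β| = s≤s⁻¹ (subst₂ _<_ (length-symα l j) (cong length (symβ≡ l≡ |R|)) ℓα<ℓβ)

-- λ = (r₁ ∷ M ++ w ∷ W) ++ j ∷ β with r₁ = λ₁, M = (λ₂, …, λ_j), w = λ_{j+1},
-- W = (λ_{j+2}, …, λ_{m+j}), m = m′ + 1, j = d + 2, and β = (β₂, β₃, …) the symbol's β without
-- its first part β₁ = j.
record Q6Form (m′ d : ℕ) : Set where
  field
    r₁ w : ℕ
    M W β : List ℕ
    length-M : length M ≡ suc d
    length-W : length W ≡ m′
    sorted-r₁M : Sorted (r₁ ∷ M)
    M≥w : All (w ≤_) M
    w≤r₁ : w ≤ r₁
    sorted-wW : Sorted (w ∷ W)
    wW-large : All (5 + d ≤_) (w ∷ W)
    sorted-β : Sorted β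
    β≥2 : All (2 ≤_) β
    β≤j : All (_≤ 2 + d) β
    r₁≤j+|β| : r₁ ≤ 2 + d + length β

  partition : List ℕ
  partition = (r₁ ∷ M ++ w ∷ W) ++ 2 + d ∷ β

rows⇒Q6Form : ∀ {m′ l} → Q6Rows (suc m′) l → ∃ λ d → Σ (Q6Form m′ d) λ D → Q6Form.partition D ≡ l
rows⇒Q6Form (_ , [] , _ , _ , () , _)
rows⇒Q6Form (j , _ ∷ _ , [] , refl , _ , r₁-large ∷ _ , _ , _ , _ , _ , r₁≤j+0) =
  ⊥-elim (<⇒≱ (+-monoʳ-< j (s≤s z≤n)) (≤-trans r₁-large r₁≤j+0))
rows⇒Q6Form (zero     , _ ∷ _ , _ ∷ _ , _ , _ , _ , _ , _ , s≤s (s≤s _) ∷ _ , () ∷ _     , _)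
rows⇒Q6Form (suc zero , _ ∷ _ , _ ∷ _ , _ , _ , _ , _ , _ , s≤s (s≤s _) ∷ _ , s≤s () ∷ _ , _)
rows⇒Q6Form {m′} (suc (suc d) , r₁ ∷ R′ , β , refl , |R| , _ ∷ R′-large , r₁≥R′ ∷ sorted-R′ ,
                  sorted-β , β≥2 , β≤j , r₁≤)
  with split-around (suc d) R′ (subst (suc d <_) (sym |R′|) (m≤n+m (suc (suc d)) m′))
  where
  |R′| : length R′ ≡ m′ + suc (suc d)
  |R′| = suc-injective |R|
... | M , W , w , R′≡ , |M| = d , form , cong (λ xs → (r₁ ∷ xs) ++ _ ∷ β) (sym R′≡)
  where
  split-sorted = sorted-++⁻ M (subst Sorted R′≡ sorted-R′)
  r₁≥ = All.++⁻ M (subst (All (_≤ r₁)) R′≡ r₁≥R′)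
  form : Q6Form m′ d
  form = record
    { r₁ = r₁ ; w = w ; M = M ; W = W ; β = β
    ; length-M = |M|
    ; length-W = +-cancelˡ-≡ (suc (suc d)) _ _ (begin
        suc (suc d) + length W      ≡⟨ +-suc (suc d) (length W) ⟨
        suc d + suc (length W)      ≡⟨ cong (_+ _) |M| ⟨
        length M + suc (length W)   ≡⟨ length-++ M ⟨
        length (M ++ w ∷ W)         ≡⟨ cong length R′≡ ⟨
        length R′                   ≡⟨ suc-injective |R| ⟩
        m′ + suc (suc d)            ≡⟨ +-comm m′ (suc (suc d)) ⟩
        suc (suc d) + m′            ∎)
    ; sorted-r₁M = proj₁ r₁≥ ∷ proj₁ split-sorted
    ; M≥w = All.map All.head (proj₂ (proj₂ split-sorted))
    ; w≤r₁ = All.head (proj₂ r₁≥)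
    ; sorted-wW = proj₁ (proj₂ split-sorted)
    ; wW-large = All.++⁻ʳ M (subst (All (5 + d ≤_)) R′≡
                                  (All.map (λ {x} → subst (_≤ x) (+-comm (suc (suc d)) 3)) R′-large))
    ; sorted-β = sorted-β
    ; β≥2 = β≥2
    ; β≤j = β≤j
    ; r₁≤j+|β| = r₁≤
    }
    where open ≡-Reasoning

Q6-form : ∀ {m′ n l} → InQ6 (suc m′) n l → ∃ λ d → Σ (Q6Form m′ d) λ D → Q6Form.partition D ≡ l
Q6-form q = rows⇒Q6Form (Q6-rows (s≤s z≤n) q)

-- The injection

module Image {m′ d : ℕ} (D : Q6Form m′ d) where
  open Q6Form D

  j z N L : ℕ
  j = 2 + d
  z = w ∸ (5 + d)
  N = length β + z + m′ / 2
  L = suc j + suc N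

  σ τ Tβ T μ : List ℕ
  σ  = (r₁ ∸ w + m′ % 2) ∷ map (_∸ w) M
  τ  = applyUpTo (λ i → suc (conj σ (suc i))) N
  Tβ = applyUpTo (λ i → suc (suc j) + z + conj β (3 + i)) d
  T  = Tβ ++ map (_∸ 1) (w ∷ W)
  μ  = framed (suc j) L T τ

  w≡ : w ≡ 5 + d + z
  w≡ = sym (m+[n∸m]≡n (All.head wW-large))

  length-σ : length σ ≡ j
  length-σ = cong suc (trans (length-map _ M) length-M)

  sorted-σ : Sorted σ
  sorted-σ with sorted-r₁M
  ... | r₁≥M ∷ sorted-M = All.map⁺ (All.map (λ x≤r₁ → ≤-trans (∸-monoˡ-≤ w x≤r₁) (m≤m+n _ _)) r₁≥M)
                        ∷ AllPairs.map⁺ (AllPairs.map (∸-monoˡ-≤ w) sorted-M)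

  σ≤N : All (_≤ N) σ
  σ≤N with sorted-σ
  ... | σ₁≥ ∷ _ = σ₁≤N ∷ All.map (λ x≤σ₁ → ≤-trans x≤σ₁ σ₁≤N) σ₁≥
    where
    open ≤-Reasoning
    a = r₁ ∸ w
    excess : a + (3 + z) ≤ length β
    excess = +-cancelˡ-≤ j _ _ (begin
      j + (a + (3 + z))    ≡⟨ regroup j a z ⟩
      a + (5 + d + z)      ≡⟨ cong (a +_) w≡ ⟨
      a + w                ≡⟨ m∸n+n≡m w≤r₁ ⟩
      r₁                   ≤⟨ r₁≤j+|β| ⟩
      j + length β         ∎)
      where
      regroup : ∀ j a z → j + (a + (3 + z)) ≡ a + (3 + j + z)
      regroup = solve-∀
    σ₁≤N : a + m′ % 2 ≤ N
    σ₁≤N = begin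
      a + m′ % 2       ≤⟨ +-monoʳ-≤ a (≤-trans (s≤s⁻¹ (m%n<n m′ 2)) (s≤s z≤n)) ⟩
      a + (3 + z)      ≤⟨ excess ⟩
      length β         ≤⟨ m≤m+n _ _ ⟩
      length β + z     ≤⟨ m≤m+n _ _ ⟩
      N                ∎

  sorted-τ : Sorted τ
  sorted-τ = sorted-applyUpTo N (λ i≤k → s≤s (conj-antitone σ (s≤s i≤k)))

  τ-positive : All (1 ≤_) τ
  τ-positive = All.applyUpTo⁺₂ _ N (λ _ → s≤s z≤n)

  τ≤suc-j : All (_≤ suc j) τ
  τ≤suc-j = All.applyUpTo⁺₂ _ N (λ i → s≤s (subst (conj σ (suc i) ≤_) length-σ (conj-≤length σ (suc i))))

  length-τ : length τ ≡ N
  length-τ = length-applyUpTo _ N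

  length-T : suc m′ + suc j ≡ 3 + length T
  length-T = begin
    suc m′ + suc j                          ≡⟨ regroup m′ d ⟩
    3 + (d + suc m′)                        ≡⟨ cong₂ (λ a b → 3 + (a + b)) (length-applyUpTo _ d)
                                                 (trans (length-map _ (w ∷ W)) (cong suc length-W)) ⟨
    3 + (length Tβ + length (map _ (w ∷ W))) ≡⟨ cong (3 +_) (length-++ Tβ) ⟨
    3 + length T                            ∎
    where
    open ≡-Reasoning
    regroup : ∀ m′ d → suc m′ + suc (2 + d) ≡ 3 + (d + suc m′)
    regroup = solve-∀

  c : ℕ
  c = suc (suc j) + z

  wW∸1≤c : All (_≤ c) (map (_∸ 1) (w ∷ W))
  wW∸1≤c with sorted-wW
  ... | w≥W ∷ _ =
    All.map⁺ (All.map (λ x≤w → ≤-trans (∸-monoˡ-≤ 1 x≤w) (≤-reflexive (cong (_∸ 1) w≡))) (≤-refl ∷ w≥W))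

  sorted-T : Sorted T
  sorted-T = sorted-++ (sorted-applyUpTo d (λ i≤k → +-monoʳ-≤ c (conj-antitone β (s≤s (s≤s (s≤s i≤k))))))
                       (AllPairs.map⁺ (AllPairs.map (∸-monoˡ-≤ 1) sorted-wW))
                       (All.applyUpTo⁺₂ _ d (λ _ → m≤m+n c _))
                       wW∸1≤c

  T-large : All (suc (suc j) ≤_) T
  T-large = All.++⁺ (All.applyUpTo⁺₂ _ d (λ _ → ≤-trans (m≤m+n _ z) (m≤m+n c _)))
                    (All.map⁺ (All.map (∸-monoˡ-≤ 1) wW-large))

  L≥T : All (_≤ L) T
  L≥T = All.++⁺ (All.applyUpTo⁺₂ _ d (λ i → ≤-trans (+-monoʳ-≤ c (conj-≤length β _)) c+|β|≤L))
                (All.map (λ x≤c → ≤-trans x≤c (≤-trans (m≤m+n c _) c+|β|≤L)) wW∸1≤c)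
    where
    c+|β|≤L : c + length β ≤ L
    c+|β|≤L = subst (c + length β ≤_) (regroup j z (length β) (m′ / 2)) (m≤m+n (c + length β) (m′ / 2))
      where
      regroup : ∀ j z b k → suc (suc j) + z + b + k ≡ suc j + suc (b + z + k)
      regroup = solve-∀

  μ-InP6 : InP6 (suc m′) (sum μ) μ
  μ-InP6 = framed-InP6 (suc m′) j L T τ (L≥T ∷ sorted-T) T-large sorted-τ τ-positive τ≤suc-j length-T
                       (cong (λ n → suc j + suc n) (sym length-τ))

  μ-IsDurfee : IsDurfee (suc m′) μ (3 + d)
  μ-IsDurfee = proj₁ (proj₂ (proj₂ μ-InP6))

  sum-μ : sum μ ≡ sum partition
  sum-μ = begin
    sum μ
      ≡⟨ cong (L +_) (sum-++ T (suc j ∷ suc j ∷ suc j ∷ τ)) ⟩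
    L + (sum T + (suc j + (suc j + (suc j + sum τ))))
      ≡⟨ cong₂ (λ t u → L + (t + (suc j + (suc j + (suc j + u))))) sum-T sum-τ ⟩
    L + (d * c + X + PW + (suc j + (suc j + (suc j + (N * 1 + (a + m′ % 2 + PM))))))
      ≡⟨ identity a (length β) d (m′ / 2) (m′ % 2) z X PM PW ⟩
    cells (5 + d + z) (m′ % 2 + m′ / 2 * 2)
      ≡⟨ cong₂ cells w≡ (m≡m%n+[m/n]*n m′ 2) ⟨
    cells w m′
      ≡⟨ cong₂ _+_ (cong₂ _+_ (m∸n+n≡m w≤r₁) (cong₂ _+_ sum-M sum-wW)) (cong (j +_) sum-β) ⟩
    r₁ + (sum M + sum (w ∷ W)) + (j + sum β)
      ≡⟨ cong (λ x → r₁ + x + (j + sum β)) (sum-++ M (w ∷ W)) ⟨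
    r₁ + sum (M ++ w ∷ W) + (j + sum β)
      ≡⟨ sum-++ (r₁ ∷ M ++ w ∷ W) (j ∷ β) ⟨
    sum partition
      ∎
    where
    open ≡-Reasoning
    a = r₁ ∸ w
    X = sum (applyUpTo (λ i → conj β (3 + i)) d)
    PM = sum (map (_∸ w) M)
    PW = sum (map (_∸ 1) (w ∷ W))
    cells : ℕ → ℕ → ℕ
    cells w m′ = a + w + (PM + suc d * w + (PW + suc m′ * 1)) + (j + (length β + (length β + X)))
    sum-T : sum T ≡ d * c + X + PW
    sum-T = trans (sum-++ Tβ _) (cong (_+ PW) (trans (sum-applyUpTo-+ (λ _ → c) (λ i → conj β (3 + i)) d)
                                                     (cong (_+ X) (sum-applyUpTo-const c d))))
    sum-τ : sum τ ≡ N * 1 + (a + m′ % 2 + PM)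
    sum-τ = trans (sum-applyUpTo-+ (λ _ → 1) (λ i → conj σ (suc i)) N)
                  (cong₂ _+_ (sum-applyUpTo-const 1 N) (sum-conj σ σ≤N))
    sum-M : PM + suc d * w ≡ sum M
    sum-M = subst (λ n → PM + n * w ≡ sum M) length-M (sum-map-∸ M M≥w)
    sum-wW : PW + suc m′ * 1 ≡ sum (w ∷ W)
    sum-wW = subst (λ n → PW + suc n * 1 ≡ sum (w ∷ W)) length-W
                   (sum-map-∸ (w ∷ W) (All.map (≤-trans (s≤s z≤n)) wW-large))
    sum-β : length β + (length β + X) ≡ sum β
    sum-β = trans (sym (cong₂ (λ p q → p + (q + X)) (conj-≡length β (All.map (≤-trans (s≤s z≤n)) β≥2))
                                                     (conj-≡length β β≥2)))
                  (sum-conj β β≤j)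
    identity : ∀ a b d k r z X PM PW →
      suc (suc (suc d)) + suc (b + z + k)
        + (d * (4 + d + z) + X + PW + (3 + d + (3 + d + (3 + d + ((b + z + k) * 1 + (a + r + PM))))))
      ≡ a + (5 + d + z) + (PM + suc d * (5 + d + z) + (PW + suc (r + k * 2) * 1)) + (2 + d + (b + (b + X)))
    identity = solve-∀

module _ {m′ d : ℕ} (D D′ : Q6Form m′ d) (same : Image.μ D ≡ Image.μ D′) where
  private
    module F  = Q6Form D
    module F′ = Q6Form D′
    module A  = Image D
    module B  = Image D′

  private
    T≡×τ≡ : A.T ≡ B.T × A.τ ≡ B.τ
    T≡×τ≡ = framed-injective A.T B.T (suc-injective (suc-injective (suc-injective
                                        (trans (sym A.length-T) B.length-T)))) same

    Tβ≡×wW≡ : A.Tβ ≡ B.Tβ × map (_∸ 1) (F.w ∷ F.W) ≡ map (_∸ 1) (F′.w ∷ F′.W)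
    Tβ≡×wW≡ = ++-injective A.Tβ B.Tβ (trans (length-applyUpTo _ d) (sym (length-applyUpTo _ d))) (proj₁ T≡×τ≡)

    wW≡ : F.w ∷ F.W ≡ F′.w ∷ F′.W
    wW≡ = map-∸-injective _ _ (All.map (≤-trans (s≤s z≤n)) F.wW-large) (All.map (≤-trans (s≤s z≤n)) F′.wW-large)
                              (proj₂ Tβ≡×wW≡)

    w≡ : F.w ≡ F′.w
    w≡ = ∷-injectiveˡ wW≡

    N≡ : A.N ≡ B.N
    N≡ = trans (sym A.length-τ) (trans (cong length (proj₂ T≡×τ≡)) B.length-τ)

    σ≡ : A.σ ≡ B.σ
    σ≡ = conj-injective A.σ B.σ A.sorted-σ B.sorted-σ (trans A.length-σ (sym B.length-σ))
                        A.σ≤N (subst (λ n → All (_≤ n) B.σ) (sym N≡) B.σ≤N)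
                        (λ i<N → suc-injective (applyUpTo-injective A.N τ≡ i<N))
      where
      τ≡ : A.τ ≡ applyUpTo (λ i → suc (conj B.σ (suc i))) A.N
      τ≡ = trans (proj₂ T≡×τ≡) (cong (applyUpTo _) (sym N≡))

    r₁≡ : F.r₁ ≡ F′.r₁
    r₁≡ = begin
      F.r₁                         ≡⟨ m∸n+n≡m F.w≤r₁ ⟨
      F.r₁ ∸ F.w + F.w             ≡⟨ cong₂ _+_ (+-cancelʳ-≡ (m′ % 2) _ _ (∷-injectiveˡ σ≡)) w≡ ⟩
      F′.r₁ ∸ F′.w + F′.w          ≡⟨ m∸n+n≡m F′.w≤r₁ ⟩
      F′.r₁                        ∎
      where open ≡-Reasoning

    M≡ : F.M ≡ F′.M
    M≡ = map-∸-injective F.M F′.M F.M≥w (subst (λ w → All (w ≤_) F′.M) (sym w≡) F′.M≥w)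
                         (trans (∷-injectiveʳ σ≡) (cong (λ w → map (_∸ w) F′.M) (sym w≡)))

    z≡ : A.z ≡ B.z
    z≡ = cong (_∸ (5 + d)) w≡

    |β|≡ : length F.β ≡ length F′.β
    |β|≡ = +-cancelʳ-≡ A.z _ _ (+-cancelʳ-≡ (m′ / 2) _ _
             (trans N≡ (cong (λ z → length F′.β + z + m′ / 2) (sym z≡))))

    β≡ : F.β ≡ F′.β
    β≡ = conj-injective F.β F′.β F.sorted-β F′.sorted-β |β|≡ F.β≤j F′.β≤j agree
      where
      agree : ∀ {i} → i < 2 + d → conj F.β (suc i) ≡ conj F′.β (suc i)
      agree {zero}        _ = trans (conj-≡length F.β (All.map (≤-trans (s≤s z≤n)) F.β≥2))
                                (trans |β|≡ (sym (conj-≡length F′.β (All.map (≤-trans (s≤s z≤n)) F′.β≥2))))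
      agree {suc zero}    _ = trans (conj-≡length F.β F.β≥2) (trans |β|≡ (sym (conj-≡length F′.β F′.β≥2)))
      agree {suc (suc i)} (s≤s (s≤s i<d)) =
        +-cancelˡ-≡ A.c _ _ (trans (applyUpTo-injective d (proj₁ Tβ≡×wW≡) i<d)
                                   (cong (λ z → 4 + d + z + conj F′.β (3 + i)) (sym z≡)))

  image-injective-same-d : Q6Form.partition D ≡ Q6Form.partition D′
  image-injective-same-d = cong₂ (λ rows β → rows ++ 2 + d ∷ β) (cong₂ _∷_ r₁≡ (cong₂ _++_ M≡ wW≡)) β≡

image-injective : ∀ {m′ d d′} (D : Q6Form m′ d) (D′ : Q6Form m′ d′) →
  Image.μ D ≡ Image.μ D′ → Q6Form.partition D ≡ Q6Form.partition D′
image-injective {m′} {d} {d′} D D′ same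
  with IsDurfee-unique {suc m′} {Image.μ D} (Image.μ-IsDurfee D)
                      (subst (λ μ → IsDurfee (suc m′) μ (3 + d′)) (sym same) (Image.μ-IsDurfee D′))
... | refl = image-injective-same-d D D′ same

Q6→P6 : ∀ {m′ n} → Q6 (suc m′) n → P6 (suc m′) n
Q6→P6 {m′} (l , q@(((_ , _ , sum≡n) , _) , _)) =
  Image.μ D , subst (λ n → InP6 (suc m′) n (Image.μ D)) sum≡ (Image.μ-InP6 D)
  where
  D = proj₁ (proj₂ (Q6-form q))
  sum≡ = trans (Image.sum-μ D) (trans (cong sum (proj₂ (proj₂ (Q6-form q)))) sum≡n)

lemma4p5 : (m n : ℕ) → 1 ≤ m →
    Σ (Q6 m n → P6 m n) λ f → (x y : Q6 m n) → proj₁ (f x) ≡ proj₁ (f y) → proj₁ x ≡ proj₁ y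
lemma4p5 (suc m′) n _ = Q6→P6 , injective
  where
  injective : (x y : Q6 (suc m′) n) → proj₁ (Q6→P6 x) ≡ proj₁ (Q6→P6 y) → proj₁ x ≡ proj₁ y
  injective (l , q) (l′ , q′) same =
    trans (sym (proj₂ (proj₂ (Q6-form q))))
          (trans (image-injective (proj₁ (proj₂ (Q6-form q))) (proj₁ (proj₂ (Q6-form q′))) same)
                 (proj₂ (proj₂ (Q6-form q′))))
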